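{- A Dyck path $P$ satisfies $F(P)=P$ if and only if $P$ contains no subpath $DUDD$ and no subpath of the form $UUP^{+}DD$ where $P^{+}$ is a nonempty Dyck path.
   Context: Dyck paths are words in the letters $U$ (upstep) and $D$ (downstep) with equally many $U$'s and $D$'s such that every prefix contains at least as many $U$'s as $D$'s. A subpath means a factor, i.e. a block of consecutive steps. The size is the number of $U$'s; $\epsilon$ is the empty path; powers denote repetition. A nonempty Dyck path is primitive if no nonempty proper prefix of it is a Dyck path; every nonempty Dyck path is uniquely a concatenation of primitive Dyck paths, its components. The map $F$ on Dyck paths is defined recursively: $F(\epsilon)=\epsilon$; if $P$ has components $P_1,\dots,P_r$ with $r\ge 2$ then $F(P)=F(P_1)\cdots F(P_r)$; every primitive $P$ can be written uniquely as $P=UQ(UD)^iD$ with $i\ge 0$ and $Q$ a Dyck path that is either empty or ends with $DD$, and then $F(P)=U^{i+1}F(R)\,UD\,D^{i+1}$ if $Q$ is primitive, say $Q=URD$, while $F(P)=U^{i+1}F(Q)D^{i+1}$ if $Q$ is not primitive (including $Q=\epsilon$). -}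

module Defs where

open import Data.Nat using (ℕ; zero; suc)
open import Data.List using (List; []; _∷_; _++_; length; reverse; concatMap; replicate)
open import Data.Product using (_×_; _,_; ∃-syntax)
open import Relation.Binary.PropositionalEquality using (_≡_)

data Step : Set where
  U D : Step

Word : Set
Word = List Step

-- Bal h w : starting at height h, the word w never goes below 0 and ends at height 0.
data Bal : ℕ → Word → Set where
  bal-[] : Bal 0 []
  bal-U  : ∀ {h w} → Bal (suc h) w → Bal h (U ∷ w)
  bal-D  : ∀ {h w} → Bal h w → Bal (suc h) (D ∷ w)

IsDyck : Word → Set
IsDyck = Bal 0

Factor : Word → Word → Set
Factor s w = ∃[ xs ] ∃[ ys ] (w ≡ xs ++ s ++ ys)

-- cut h w : reading w starting at height h ≥ 1, return the prefix up to and
-- including the first step returning to height 0, and the remainder.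
cut : ℕ → Word → Word × Word
cut h [] = [] , []
cut h (U ∷ w) with cut (suc h) w
... | a , b = U ∷ a , b
cut zero (D ∷ w) = [] , D ∷ w   -- does not occur for Dyck input
cut (suc zero) (D ∷ w) = D ∷ [] , w
cut (suc (suc h)) (D ∷ w) with cut (suc h) w
... | a , b = D ∷ a , b

compsF : ℕ → Word → List Word
compsF zero w = []
compsF (suc n) [] = []
compsF (suc n) (U ∷ w) with cut 1 w
... | a , b = (U ∷ a) ∷ compsF n b
compsF (suc n) (D ∷ w) = []      -- does not occur for Dyck input

components : Word → List Word
components w = compsF (length w) w

dropLast : Word → Word
dropLast [] = []
dropLast (x ∷ []) = []
dropLast (x ∷ y ∷ w) = x ∷ dropLast (y ∷ w)

inner : Word → Word
inner [] = []
inner (x ∷ w) = dropLast w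

-- strip a maximal number of leading (D U) from a reversed word,
-- i.e. strip maximal trailing (U D) from the original word.
stripRev : Word → Word × ℕ
stripRev (D ∷ U ∷ w) with stripRev w
... | r , i = r , suc i
stripRev w = w , 0

-- M = Q (UD)^i  with Q empty or ending in DD (for Dyck M)
splitQ : Word → Word × ℕ
splitQ m with stripRev (reverse m)
... | r , i = reverse r , i

-- The map F, with fuel (fuel = length of the word suffices).

mutual
  FF : ℕ → Word → Word
  FF zero w = []
  FF (suc n) w = concatMap (Fprim n) (components w)

  -- F on a primitive path P = U Q (UD)^i D
  Fprim : ℕ → Word → Word
  Fprim n p with splitQ (inner p)
  ... | q , i with components q
  ...   | _ ∷ [] = replicate (suc i) U ++ FF n (inner q) ++ (U ∷ D ∷ []) ++ replicate (suc i) D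
  ...   | _      = replicate (suc i) U ++ FF n q ++ replicate (suc i) D

F : Word → Word
F w = FF (length w) w

-- A Dyck path is a sequence of arches U a D, and F acts arch by arch without changing lengths, so
-- F P = P iff F fixes every arch. Call a safe if it is UD or does not end in UD, and it is not
-- primitive with nonempty interior. Splitting a = q (UD)^i as F does, a case analysis on i and on the
-- number of components of q shows that F fixes U a D iff a is safe and F fixes a; whenever a is not
-- safe, one side of F(U a D) = U a D ends in UDD and the other in DDD. On the pattern side, U a D b
-- avoids both patterns iff a and b do and a is safe: a new occurrence must use the closing D of the
-- arch, and a DUDD there means that a ends in DUD, a UU P⁺ DD there that a = U P⁺ D.

module Submission where

open import Defs
open import Data.List using (List; []; _∷_; _++_; _∷ʳ_; length; reverse; replicate; concatMap; _∷ʳ′_; initLast)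
open import Data.List.Properties
  using (++-assoc; ++-identityʳ; ++-cancelʳ; ++-conicalʳ; ∷-injectiveˡ; ∷-injectiveʳ;
         length-++; length-++-≤ˡ; length-++-≤ʳ; length-replicate; reverse-++; reverse-involutive)
open import Data.Nat using (ℕ; zero; suc; _+_; _≤_; _<_; z≤n; s≤s)
open import Data.Nat.Properties
  using (≤-refl; ≤-trans; ≤-reflexive; <-irrefl; n≤1+n; m≤m+n; +-suc; +-identityʳ; +-cancelʳ-≡; suc-injective)
open import Data.Nat.Tactic.RingSolver using (solve-∀)
open import Data.Product using (_×_; _,_; proj₁; proj₂; ∃-syntax; ∃₂)
open import Data.Product.Function.NonDependent.Propositional using (_×-⇔_)
open import Data.Sum using (_⊎_; inj₁; inj₂)
open import Data.Empty using (⊥-elim)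
open import Function using (case_of_)
open import Function.Bundles using (_⇔_; mk⇔)
open import Function.Properties.Equivalence using (⇔-setoid) renaming (trans to ⇔-trans)
open import Level using (0ℓ)
open import Relation.Nullary using (¬_)
open import Relation.Binary.PropositionalEquality
import Relation.Binary.Reasoning.Setoid as SetoidReasoning

module ⇔-Reasoning = SetoidReasoning (⇔-setoid 0ℓ)

private variable
  A : Set
  a b q r w x x' y y' : Word
  h j k n i : ℕ

EndsWith StartsWith : Word → Word → Set
EndsWith s w = ∃[ x ] (w ≡ x ++ s)
StartsWith s w = ∃[ y ] (w ≡ s ++ y)

endsWith-++ˡ : ∀ x {s w} → EndsWith s w → EndsWith s (x ++ w)
endsWith-++ˡ x {s} (y , refl) = x ++ y , sym (++-assoc x y s)

endsWith-++ʳ : ∀ t {s w} → EndsWith s w → EndsWith (s ++ t) (w ++ t)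
endsWith-++ʳ t {s} (y , refl) = y , ++-assoc y s t

++-≡-++ : ∀ (x y u v : List A) → x ++ y ≡ u ++ v →
  (∃[ z ] (u ≡ x ++ z × y ≡ z ++ v)) ⊎ (∃[ z ] (x ≡ u ++ z × v ≡ z ++ y))
++-≡-++ []      y u       v e = inj₁ (u , refl , e)
++-≡-++ (c ∷ x) y []      v e = inj₂ (c ∷ x , refl , sym e)
++-≡-++ (c ∷ x) y (d ∷ u) v e with ∷-injectiveˡ e | ++-≡-++ x y u v (∷-injectiveʳ e)
... | refl | inj₁ (z , e₁ , e₂) = inj₁ (z , cong (c ∷_) e₁ , e₂)
... | refl | inj₂ (z , e₁ , e₂) = inj₂ (z , cong (c ∷_) e₁ , e₂)

++-cancel-length : ∀ (x x' : List A) {y y'} → length x ≡ length x' → x ++ y ≡ x' ++ y' → x ≡ x' × y ≡ y'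
++-cancel-length []      []        _ e = refl , e
++-cancel-length (c ∷ x) (c' ∷ x') l e with ∷-injectiveˡ e | ++-cancel-length x x' (suc-injective l) (∷-injectiveʳ e)
... | refl | e₁ , e₂ = cong (c ∷_) e₁ , e₂

++-≡-++⇔ : ∀ (x x' : List A) {y y'} → length x ≡ length x' → (x ++ y ≡ x' ++ y') ⇔ (x ≡ x' × y ≡ y')
++-≡-++⇔ x x' l = mk⇔ (++-cancel-length x x' l) (λ (e₁ , e₂) → cong₂ _++_ e₁ e₂)

endsWith-unique : ∀ {s s' w} → length s ≡ length s' → EndsWith s w → EndsWith s' w → s ≡ s'
endsWith-unique {s} {s'} l (x , refl) (x' , e) = proj₂ (++-cancel-length x x' lx e)
  where
  lx : length x ≡ length x'
  lx = +-cancelʳ-≡ _ _ _ (begin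
    length x + length s   ≡⟨ sym (length-++ x) ⟩
    length (x ++ s)       ≡⟨ cong length e ⟩
    length (x' ++ s')     ≡⟨ length-++ x' ⟩
    length x' + length s' ≡⟨ cong (length x' +_) (sym l) ⟩
    length x' + length s  ∎)
    where open ≡-Reasoning

endsWith-DDD⇒¬UDD : EndsWith (D ∷ D ∷ D ∷ []) w → ¬ EndsWith (U ∷ D ∷ D ∷ []) w
endsWith-DDD⇒¬UDD e e' with endsWith-unique refl e e'
... | ()

endsWith-D-replicate : EndsWith (D ∷ []) w → ∀ k → EndsWith (D ∷ D ∷ D ∷ []) (w ++ replicate (suc (suc k)) D)
endsWith-D-replicate (y , refl) zero    = y , ++-assoc y (D ∷ []) (D ∷ D ∷ [])
endsWith-D-replicate {w} _      (suc k) = endsWith-++ˡ w (endsWith-D-replicate ([] , refl) k)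

factor-trans : ∀ {s} → Factor s x → Factor x w → Factor s w
factor-trans {s = s} (xs , ys , refl) (xs' , ys' , refl) = xs' ++ xs , ys ++ ys' , (begin
  xs' ++ (xs ++ s ++ ys) ++ ys' ≡⟨ cong (xs' ++_) (++-assoc xs (s ++ ys) ys') ⟩
  xs' ++ xs ++ (s ++ ys) ++ ys' ≡⟨ sym (++-assoc xs' xs _) ⟩
  (xs' ++ xs) ++ (s ++ ys) ++ ys' ≡⟨ cong ((xs' ++ xs) ++_) (++-assoc s ys ys') ⟩
  (xs' ++ xs) ++ s ++ ys ++ ys' ∎)
  where open ≡-Reasoning

factor-∷⁻ : ∀ {s c} → Factor s (c ∷ w) → StartsWith s (c ∷ w) ⊎ Factor s w
factor-∷⁻ ([]     , ys , e) = inj₁ (ys , e)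
factor-∷⁻ (_ ∷ xs , ys , e) = inj₂ (xs , ys , ∷-injectiveʳ e)

factor-around : ∀ {s} a c b → s ≢ [] → Factor s (a ++ c ∷ b) →
  Factor s a ⊎ Factor s b ⊎ (∃₂ λ z z' → EndsWith z a × s ≡ z ++ c ∷ z' × StartsWith z' b)
factor-around {s} a c b s≢[] (xs , ys , e) with ++-≡-++ a (c ∷ b) xs (s ++ ys) e
factor-around {[]}    a c b s≢[] _ | inj₁ ([] , _ , _) = ⊥-elim (s≢[] refl)
factor-around {_ ∷ s} a c b _    _ | inj₁ ([] , _ , e₂) with refl ← ∷-injectiveˡ e₂ =
  inj₂ (inj₂ ([] , s , (a , sym (++-identityʳ a)) , refl , (_ , ∷-injectiveʳ e₂)))
... | inj₁ (_ ∷ z , _ , e₂) = inj₂ (inj₁ (z , _ , ∷-injectiveʳ e₂))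
... | inj₂ (z , e₁ , e₂) with ++-≡-++ s _ z (c ∷ b) e₂
...   | inj₁ (w , f₁ , _) = inj₁ (xs , w , trans e₁ (cong (xs ++_) f₁))
...   | inj₂ ([] , f₁ , _) =
  inj₁ (xs , [] , trans e₁ (cong (xs ++_) (sym (trans (++-identityʳ s) (trans f₁ (++-identityʳ z))))))
...   | inj₂ (d ∷ w , f₁ , f₂) with refl ← ∷-injectiveˡ f₂ =
  inj₂ (inj₂ (z , w , (xs , e₁) , f₁ , (_ , ∷-injectiveʳ f₂)))

ups downs : Word → ℕ
ups []      = 0
ups (U ∷ w) = suc (ups w)
ups (D ∷ w) = ups w
downs []      = 0
downs (U ∷ w) = downs w
downs (D ∷ w) = suc (downs w)

Bal-count : Bal h w → ups w + h ≡ downs w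
Bal-count bal-[] = refl
Bal-count {h} (bal-U {w = w} p) = trans (sym (+-suc (ups w) h)) (Bal-count p)
Bal-count {suc h} (bal-D {w = w} p) = trans (+-suc (ups w) h) (cong suc (Bal-count p))

Bal-unique : Bal h w → Bal k w → h ≡ k
Bal-unique bal-[]    bal-[]    = refl
Bal-unique (bal-U p) (bal-U p') = suc-injective (Bal-unique p p')
Bal-unique (bal-D p) (bal-D p') = cong suc (Bal-unique p p')

Bal-++ : Bal j x → Bal k y → Bal (j + k) (x ++ y)
Bal-++ bal-[]    q = q
Bal-++ (bal-U p) q = bal-U (Bal-++ p q)
Bal-++ (bal-D p) q = bal-D (Bal-++ p q)

Bal-++⁻ʳ : ∀ x → Bal h (x ++ y) → ∃[ k ] Bal k y
Bal-++⁻ʳ []      p         = _ , p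
Bal-++⁻ʳ (U ∷ x) (bal-U p) = Bal-++⁻ʳ x p
Bal-++⁻ʳ (D ∷ x) (bal-D p) = Bal-++⁻ʳ x p

Bal-++⁻ˡ : ∀ x → Bal h (x ++ y) → IsDyck y → Bal h x
Bal-++⁻ˡ []      p         py with refl ← Bal-unique p py = bal-[]
Bal-++⁻ˡ (U ∷ x) (bal-U p) py = bal-U (Bal-++⁻ˡ x p py)
Bal-++⁻ˡ (D ∷ x) (bal-D p) py = bal-D (Bal-++⁻ˡ x p py)

Bal-before-D : ∀ x → Bal h (x ++ D ∷ y) → downs x < ups x + h
Bal-before-D         []      (bal-D p) = s≤s z≤n
Bal-before-D {h}     (U ∷ x) (bal-U p) = ≤-trans (Bal-before-D x p) (≤-reflexive (+-suc (ups x) h))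
Bal-before-D {suc h} (D ∷ x) (bal-D p) = ≤-trans (s≤s (Bal-before-D x p)) (≤-reflexive (sym (+-suc (ups x) h)))

Bal-after-U : ∀ x → Bal h (x ++ U ∷ y) → ups y < downs y
Bal-after-U {y = y} x p with Bal-++⁻ʳ x p
... | k , bal-U p' = ≤-trans (s≤s (m≤m+n (ups y) k)) (≤-reflexive (trans (sym (+-suc (ups y) k)) (Bal-count p')))

Dyck-endsWith-D : IsDyck w → w ≢ [] → EndsWith (D ∷ []) w
Dyck-endsWith-D {w} p w≢[] with initLast w
... | []        = ⊥-elim (w≢[] refl)
... | x ∷ʳ′ U   = ⊥-elim (<-irrefl refl (Bal-after-U x p))
... | x ∷ʳ′ D   = x , refl

¬Dyck-UDD : ¬ IsDyck (U ∷ D ∷ D ∷ w)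
¬Dyck-UDD (bal-U (bal-D ()))

-- First-return decomposition

data DyckTree : Word → Set where
  empty : DyckTree []
  arch  : DyckTree a → DyckTree b → DyckTree (U ∷ a ++ D ∷ b)

fromTree : DyckTree w → IsDyck w
fromTree empty         = bal-[]
fromTree (arch ta tb)  = bal-U (Bal-++ (fromTree ta) (bal-D (fromTree tb)))

data Forest : ℕ → Word → Set where
  [_]  : DyckTree w → Forest 0 w
  _D∷_ : DyckTree a → Forest h w → Forest (suc h) (a ++ D ∷ w)

graft : DyckTree a → Forest h w → Forest h (U ∷ a ++ D ∷ w)
graft ta [ tb ] = [ arch ta tb ]
graft {a} ta (_D∷_ {b} {w = w} tb f) = subst (Forest _) (cong (U ∷_) (++-assoc a (D ∷ b) (D ∷ w))) (arch ta tb D∷ f)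

toForest : Bal h w → Forest h w
toForest bal-[]    = [ empty ]
toForest (bal-D p) = empty D∷ toForest p
toForest (bal-U p) with toForest p
... | ta D∷ f = graft ta f

toTree : IsDyck w → DyckTree w
toTree p with toForest p
... | [ t ] = t

cut-arch : Bal j a → ∀ b → cut (suc j) (a ++ D ∷ b) ≡ (a ++ D ∷ [] , b)
cut-arch bal-[]    b = refl
cut-arch (bal-U p) b rewrite cut-arch p b = refl
cut-arch (bal-D p) b rewrite cut-arch p b = refl

firstReturn-unique : IsDyck x → IsDyck x' → x ++ D ∷ y ≡ x' ++ D ∷ y' → x ≡ x' × y ≡ y'
firstReturn-unique {x} {x'} {y} {y'} p p' e with trans (sym (cut-arch p y)) (trans (cong (cut 1) e) (cut-arch p' y'))
... | e' = ++-cancelʳ (D ∷ []) x x' (cong proj₁ e') , cong proj₂ e'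

arches : DyckTree w → List Word
arches empty               = []
arches (arch {a} ta tb)    = (U ∷ a ++ D ∷ []) ∷ arches tb

compsF-arches : (t : DyckTree w) → length w ≤ k → compsF k w ≡ arches t
compsF-arches {k = zero}  empty _ = refl
compsF-arches {k = suc k} empty _ = refl
compsF-arches {k = suc k} (arch {a} {b} ta tb) (s≤s le) rewrite cut-arch (fromTree ta) b =
  cong ((U ∷ a ++ D ∷ []) ∷_) (compsF-arches tb (≤-trans (≤-trans (n≤1+n _) (length-++-≤ʳ (D ∷ b) {a})) le))

components-arches : (t : DyckTree w) → components w ≡ arches t
components-arches t = compsF-arches t ≤-refl

-- Splitting off trailing peaks

peaks valleys : ℕ → Word
peaks zero      = []
peaks (suc i)   = U ∷ D ∷ peaks i
valleys zero    = []
valleys (suc i) = D ∷ U ∷ valleys i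

peaks-Dyck : ∀ i → IsDyck (peaks i)
peaks-Dyck zero    = bal-[]
peaks-Dyck (suc i) = bal-U (bal-D (peaks-Dyck i))

peaks-∷ʳ : ∀ i → peaks (suc i) ≡ peaks i ++ U ∷ D ∷ []
peaks-∷ʳ zero    = refl
peaks-∷ʳ (suc i) = cong (λ w → U ∷ D ∷ w) (peaks-∷ʳ i)

reverse-valleys : ∀ i → reverse (valleys i) ≡ peaks i
reverse-valleys zero    = refl
reverse-valleys (suc i) = begin
  reverse (D ∷ U ∷ valleys i)            ≡⟨ reverse-++ (D ∷ U ∷ []) (valleys i) ⟩
  reverse (valleys i) ++ U ∷ D ∷ []      ≡⟨ cong (_++ U ∷ D ∷ []) (reverse-valleys i) ⟩
  peaks i ++ U ∷ D ∷ []                  ≡⟨ sym (peaks-∷ʳ i) ⟩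
  peaks (suc i)                          ∎
  where open ≡-Reasoning

stripRev-sound : ∀ w → w ≡ valleys (proj₂ (stripRev w)) ++ proj₁ (stripRev w)
stripRev-sound (D ∷ U ∷ w) = cong (λ v → D ∷ U ∷ v) (stripRev-sound w)
stripRev-sound []          = refl
stripRev-sound (U ∷ w)     = refl
stripRev-sound (D ∷ [])    = refl
stripRev-sound (D ∷ D ∷ w) = refl

stripRev-maximal : ∀ w → ¬ StartsWith (D ∷ U ∷ []) (proj₁ (stripRev w))
stripRev-maximal (D ∷ U ∷ w) = stripRev-maximal w
stripRev-maximal []          ()
stripRev-maximal (U ∷ w)     ()
stripRev-maximal (D ∷ [])    ()
stripRev-maximal (D ∷ D ∷ w) ()

splitQ-sound : ∀ a → a ≡ proj₁ (splitQ a) ++ peaks (proj₂ (splitQ a))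
splitQ-sound a = begin
  a                                  ≡⟨ sym (reverse-involutive a) ⟩
  reverse (reverse a)                ≡⟨ cong reverse (stripRev-sound (reverse a)) ⟩
  reverse (valleys m ++ v)           ≡⟨ reverse-++ (valleys m) v ⟩
  reverse v ++ reverse (valleys m)   ≡⟨ cong (reverse v ++_) (reverse-valleys m) ⟩
  reverse v ++ peaks m               ∎
  where
  v = proj₁ (stripRev (reverse a))
  m = proj₂ (stripRev (reverse a))
  open ≡-Reasoning

splitQ-irreducible : ∀ a → ¬ EndsWith (U ∷ D ∷ []) (proj₁ (splitQ a))
splitQ-irreducible a (y , e) = stripRev-maximal (reverse a) (reverse y , (begin
  v                              ≡⟨ sym (reverse-involutive v) ⟩
  reverse (reverse v)            ≡⟨ cong reverse e ⟩
  reverse (y ++ U ∷ D ∷ [])      ≡⟨ reverse-++ y (U ∷ D ∷ []) ⟩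
  D ∷ U ∷ reverse y              ∎))
  where
  v = proj₁ (stripRev (reverse a))
  open ≡-Reasoning

splitQ-Dyck : IsDyck a → IsDyck (proj₁ (splitQ a))
splitQ-Dyck {a} p = Bal-++⁻ˡ (proj₁ (splitQ a)) (subst IsDyck (splitQ-sound a) p) (peaks-Dyck _)

-- The forbidden patterns

HasDUDD HasUUPDD PatternFree : Word → Set
HasDUDD = Factor (D ∷ U ∷ D ∷ D ∷ [])
HasUUPDD w = ∃[ Q ] (IsDyck Q × Q ≢ [] × Factor (U ∷ U ∷ Q ++ D ∷ D ∷ []) w)
PatternFree w = ¬ HasDUDD w × ¬ HasUUPDD w

-- Closing a into an arch U a D creates a new pattern occurrence exactly when this fails.
SafeInterior : Word → Set
SafeInterior a =
  (EndsWith (U ∷ D ∷ []) a → a ≡ U ∷ D ∷ []) × (∀ r → IsDyck r → a ≡ U ∷ r ++ D ∷ [] → r ≡ [])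

factor-length : ∀ {s} → Factor s w → length s ≤ length w
factor-length {s = s} (xs , ys , refl) =
  ≤-trans (length-++-≤ˡ s) (length-++-≤ʳ (s ++ ys) {xs})

patternFree-short : length w ≤ 3 → PatternFree w
patternFree-short {w} le =
  (λ f → tooLong (factor-length f)) ,
  (λ (Q , _ , _ , f) → tooLong (≤-trans (s≤s (s≤s (length-++-≤ʳ (D ∷ D ∷ []) {Q}))) (factor-length f)))
  where
  tooLong : ¬ 4 ≤ length w
  tooLong l = <-irrefl refl (≤-trans l le)

patternFree-factor : Factor x w → PatternFree w → PatternFree x
patternFree-factor f (¬p₁ , ¬p₂) =
  (λ g → ¬p₁ (factor-trans g f)) , (λ (Q , dQ , Q≢[] , g) → ¬p₂ (Q , dQ , Q≢[] , factor-trans g f))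

arch-++ : ∀ a b → (U ∷ a ++ D ∷ []) ++ b ≡ U ∷ a ++ D ∷ b
arch-++ a b = cong (U ∷_) (++-assoc a (D ∷ []) b)

Dyck-arch : IsDyck a → IsDyck (U ∷ a ++ D ∷ [])
Dyck-arch p = bal-U (Bal-++ p (bal-D bal-[]))

patternFree⇒safeInterior : IsDyck a → PatternFree (U ∷ a ++ D ∷ b) → SafeInterior a
patternFree⇒safeInterior {b = b} da (¬DUDD , ¬UUPDD) = endsUD , notPrimitive
  where
  endsUD : EndsWith (U ∷ D ∷ []) _ → _
  endsUD (y , refl) with initLast y
  ... | []      = refl
  ... | y' ∷ʳ′ U = ⊥-elim (<-irrefl refl (Bal-after-U y' (subst IsDyck (++-assoc y' (U ∷ []) (U ∷ D ∷ [])) da)))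
  ... | y' ∷ʳ′ D = ⊥-elim (¬DUDD (U ∷ y' , b , cong (U ∷_)
    (trans (++-assoc (y' ∷ʳ D) (U ∷ D ∷ []) (D ∷ b)) (++-assoc y' (D ∷ []) (U ∷ D ∷ D ∷ b)))))
  notPrimitive : ∀ r → IsDyck r → _ ≡ U ∷ r ++ D ∷ [] → r ≡ []
  notPrimitive []      _  _ = refl
  notPrimitive (c ∷ r) dr e = ⊥-elim (¬UUPDD (c ∷ r , dr , (λ ()) , [] , b ,
    trans (cong (λ t → U ∷ t ++ D ∷ b) e)
          (cong (λ t → U ∷ U ∷ c ∷ t) (trans (++-assoc r (D ∷ []) (D ∷ b)) (sym (++-assoc r (D ∷ D ∷ []) b))))))

++-DUD≢UD : ∀ x → x ++ D ∷ U ∷ D ∷ [] ≢ U ∷ D ∷ []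
++-DUD≢UD []          ()
++-DUD≢UD (_ ∷ [])    ()
++-DUD≢UD (_ ∷ _ ∷ x) e with () ← ++-conicalʳ x _ (∷-injectiveʳ (∷-injectiveʳ e))

straddle-DUDD : IsDyck a → IsDyck b → SafeInterior a → ∀ z z' →
  EndsWith z a → D ∷ U ∷ D ∷ D ∷ [] ≡ z ++ D ∷ z' → ¬ StartsWith z' b
straddle-DUDD _  db _ []                _ _       refl (_ , refl) = ¬Dyck-UDD db
straddle-DUDD da _  _ (D ∷ U ∷ [])      _ (x , refl) refl _ =
  <-irrefl refl (Bal-after-U (x ++ D ∷ []) (subst IsDyck (sym (++-assoc x (D ∷ []) (U ∷ []))) da))
straddle-DUDD _  _  (endsUD , _) (D ∷ U ∷ D ∷ []) _ (x , refl) refl _ =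
  ++-DUD≢UD x (endsUD (x ++ D ∷ [] , sym (++-assoc x (D ∷ []) (U ∷ D ∷ []))))
straddle-DUDD _ _ _ (D ∷ U ∷ D ∷ D ∷ z) z' _ e _
  with () ← ++-conicalʳ z _ (sym (∷-injectiveʳ (∷-injectiveʳ (∷-injectiveʳ (∷-injectiveʳ e)))))
straddle-DUDD _ _ _ (U ∷ _)             _ _ () _
straddle-DUDD _ _ _ (D ∷ [])            _ _ () _
straddle-DUDD _ _ _ (D ∷ D ∷ _)         _ _ () _
straddle-DUDD _ _ _ (D ∷ U ∷ U ∷ _)     _ _ () _
straddle-DUDD _ _ _ (D ∷ U ∷ D ∷ U ∷ _) _ _ () _

-- The part z of s inside a must descend strictly (a is Dyck) but cannot descend (s is Dyck).
Dyck-straddle : ∀ {s z z'} → IsDyck a → IsDyck s → EndsWith z a → s ≢ z ++ D ∷ z'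
Dyck-straddle {z = []}     _  () _ refl
Dyck-straddle {z = D ∷ _}  _  () _ refl
Dyck-straddle {z = U ∷ z₁} da ds (x , refl) refl =
  <-irrefl refl (≤-trans (s≤s (Bal-after-U x da)) (≤-trans (Bal-before-D (U ∷ z₁) ds) (≤-reflexive (+-identityʳ _))))

noDUDD-arch : IsDyck a → IsDyck b → SafeInterior a → ¬ HasDUDD a → ¬ HasDUDD b → ¬ HasDUDD (U ∷ a ++ D ∷ b)
noDUDD-arch {a} {b} da db safe ¬DUDDa ¬DUDDb f with factor-∷⁻ f
... | inj₁ (_ , ())
... | inj₂ f' with factor-around a D b (λ ()) f'
...   | inj₁ fa                        = ¬DUDDa fa
...   | inj₂ (inj₁ fb)                 = ¬DUDDb fb
...   | inj₂ (inj₂ (z , z' , ea , e , sb)) = straddle-DUDD da db safe z z' ea e sb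

noUUPDD-arch : IsDyck a → IsDyck b → SafeInterior a → ¬ HasUUPDD a → ¬ HasUUPDD b → ¬ HasUUPDD (U ∷ a ++ D ∷ b)
noUUPDD-arch {a} {b} da db (_ , notPrimitive) ¬UUPDDa ¬UUPDDb (Q , dQ , Q≢[] , f) with factor-∷⁻ f
... | inj₁ (ys , e) = Q≢[] (notPrimitive Q dQ (proj₁ (firstReturn-unique da (Dyck-arch dQ) e')))
  where
  e' : a ++ D ∷ b ≡ (U ∷ Q ++ D ∷ []) ++ D ∷ ys
  e' = trans (∷-injectiveʳ e) (cong (U ∷_) (trans (++-assoc Q (D ∷ D ∷ []) ys) (sym (++-assoc Q (D ∷ []) (D ∷ ys)))))
... | inj₂ f' with factor-around a D b (λ ()) f'
...   | inj₁ fa                        = ¬UUPDDa (Q , dQ , Q≢[] , fa)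
...   | inj₂ (inj₁ fb)                 = ¬UUPDDb (Q , dQ , Q≢[] , fb)
...   | inj₂ (inj₂ (_ , _ , ea , e , _)) = Dyck-straddle da (bal-U (bal-U (Bal-++ dQ (bal-D (bal-D bal-[]))))) ea e

patternFree-arch : IsDyck a → IsDyck b →
  PatternFree (U ∷ a ++ D ∷ b) ⇔ ((PatternFree a × SafeInterior a) × PatternFree b)
patternFree-arch {a} {b} da db = mk⇔
  (λ pf → (patternFree-factor (U ∷ [] , D ∷ b , refl) pf , patternFree⇒safeInterior da pf) ,
          patternFree-factor (U ∷ a ++ D ∷ [] , [] , rest) pf)
  (λ ((pa , safe) , pb) → noDUDD-arch da db safe (proj₁ pa) (proj₁ pb) , noUUPDD-arch da db safe (proj₂ pa) (proj₂ pb))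
  where
  rest : U ∷ a ++ D ∷ b ≡ (U ∷ a ++ D ∷ []) ++ b ++ []
  rest = trans (sym (arch-++ a b)) (cong ((U ∷ a ++ D ∷ []) ++_) (sym (++-identityʳ b)))

-- The map F

FF-[] : ∀ n → FF n [] ≡ []
FF-[] zero    = refl
FF-[] (suc n) = refl

dropLast-∷ʳ : ∀ (w : Word) c → dropLast (w ∷ʳ c) ≡ w
dropLast-∷ʳ []          c = refl
dropLast-∷ʳ (x ∷ [])    c = refl
dropLast-∷ʳ (x ∷ y ∷ w) c = cong (x ∷_) (dropLast-∷ʳ (y ∷ w) c)

-- The last two with-clauses of Fprim on U q (UD)^i D, where cs is the list of components of q.
FprimBody : ℕ → Word → ℕ → List Word → Word
FprimBody n q i (_ ∷ []) = replicate (suc i) U ++ FF n (inner q) ++ (U ∷ D ∷ []) ++ replicate (suc i) D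
FprimBody n q i _        = replicate (suc i) U ++ FF n q ++ replicate (suc i) D

Fprim-arch : ∀ n a → Fprim n (U ∷ a ++ D ∷ []) ≡
  FprimBody n (proj₁ (splitQ a)) (proj₂ (splitQ a)) (components (proj₁ (splitQ a)))
Fprim-arch n a rewrite dropLast-∷ʳ a D with components (proj₁ (splitQ a))
... | []        = refl
... | _ ∷ []    = refl
... | _ ∷ _ ∷ _ = refl

Fprim-arches : ∀ n a (tq : DyckTree (proj₁ (splitQ a))) →
  Fprim n (U ∷ a ++ D ∷ []) ≡ FprimBody n (proj₁ (splitQ a)) (proj₂ (splitQ a)) (arches tq)
Fprim-arches n a tq = trans (Fprim-arch n a) (cong (FprimBody n _ _) (components-arches tq))

replicate-endsWith-D : ∀ i → EndsWith (D ∷ []) (replicate (suc i) D)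
replicate-endsWith-D zero    = [] , refl
replicate-endsWith-D (suc i) = endsWith-++ˡ (D ∷ []) (replicate-endsWith-D i)

FprimBody-endsWith-D : ∀ n q i cs → EndsWith (D ∷ []) (FprimBody n q i cs)
FprimBody-endsWith-D n q i (_ ∷ [])    = endsWith-++ˡ (replicate (suc i) U)
  (endsWith-++ˡ (FF n (inner q)) (endsWith-++ˡ (U ∷ D ∷ []) (replicate-endsWith-D i)))
FprimBody-endsWith-D n q i []          = endsWith-++ˡ (replicate (suc i) U)
  (endsWith-++ˡ (FF n q) (replicate-endsWith-D i))
FprimBody-endsWith-D n q i (_ ∷ _ ∷ _) = endsWith-++ˡ (replicate (suc i) U)
  (endsWith-++ˡ (FF n q) (replicate-endsWith-D i))

Fprim-endsWith-D : ∀ n a → EndsWith (D ∷ []) (Fprim n (U ∷ a ++ D ∷ []))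
Fprim-endsWith-D n a =
  subst (EndsWith (D ∷ [])) (sym (Fprim-arch n a)) (FprimBody-endsWith-D n _ _ (components (proj₁ (splitQ a))))

FF-endsWith-D : (t : DyckTree w) → w ≢ [] → length w ≤ n → EndsWith (D ∷ []) (FF n w)
FF-endsWith-D {n = zero}  empty      w≢[] _ = ⊥-elim (w≢[] refl)
FF-endsWith-D {n = zero}  (arch _ _) _    ()
FF-endsWith-D {n = suc n} t          w≢[] _ rewrite components-arches t = arches-endsWith-D t w≢[]
  where
  arches-endsWith-D : (t : DyckTree w) → w ≢ [] → EndsWith (D ∷ []) (concatMap (Fprim n) (arches t))
  arches-endsWith-D empty                 w≢[] = ⊥-elim (w≢[] refl)
  arches-endsWith-D (arch {a} _ empty)    _    = subst (EndsWith _) (sym (++-identityʳ _)) (Fprim-endsWith-D n a)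
  arches-endsWith-D (arch {a} _ t@(arch _ _)) _ = endsWith-++ˡ (Fprim n (U ∷ a ++ D ∷ [])) (arches-endsWith-D t (λ ()))

length-peaks : ∀ i → length (peaks i) ≡ i + i
length-peaks zero    = refl
length-peaks (suc i) = cong suc (trans (cong suc (length-peaks i)) (sym (+-suc i i)))

length-wrap : ∀ i {X Y} → length X ≡ length Y →
  length (replicate (suc i) U ++ X ++ replicate (suc i) D) ≡ length (U ∷ (Y ++ peaks i) ++ D ∷ [])
length-wrap i {X} {Y} l = begin
  length (replicate (suc i) U ++ X ++ replicate (suc i) D)
    ≡⟨ length-++ (replicate (suc i) U) ⟩
  length (replicate (suc i) U) + length (X ++ replicate (suc i) D)
    ≡⟨ cong₂ _+_ (length-replicate (suc i)) (trans (length-++ X) (cong₂ _+_ l (length-replicate (suc i)))) ⟩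
  suc i + (length Y + suc i)
    ≡⟨ arith i (length Y) ⟩
  suc (length Y + (i + i) + 1)
    ≡⟨ cong (λ m → suc (length Y + m + 1)) (sym (length-peaks i)) ⟩
  suc (length Y + length (peaks i) + 1)
    ≡⟨ cong suc (sym (trans (length-++ (Y ++ peaks i)) (cong (_+ 1) (length-++ Y)))) ⟩
  length (U ∷ (Y ++ peaks i) ++ D ∷ []) ∎
  where
  open ≡-Reasoning
  arith : ∀ i m → suc i + (m + suc i) ≡ suc (m + (i + i) + 1)
  arith = solve-∀

LengthPreserved : ℕ → Set
LengthPreserved n = ∀ {w} → DyckTree w → length w ≤ n → length (FF n w) ≡ length w

length-FprimBody : LengthPreserved n → (tq : DyckTree q) → ∀ i → length (q ++ peaks i) ≤ n →
  length (FprimBody n q i (arches tq)) ≡ length (U ∷ (q ++ peaks i) ++ D ∷ [])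
length-FprimBody {n} _ empty i _ rewrite FF-[] n = length-wrap i {[]} {[]} refl
length-FprimBody {n} preserved tq@(arch {r} tr empty) i le rewrite dropLast-∷ʳ r D = begin
  length (replicate (suc i) U ++ FF n r ++ (U ∷ D ∷ []) ++ replicate (suc i) D)
    ≡⟨ cong (λ w → length (replicate (suc i) U ++ w)) (sym (++-assoc (FF n r) (U ∷ D ∷ []) _)) ⟩
  length (replicate (suc i) U ++ (FF n r ++ U ∷ D ∷ []) ++ replicate (suc i) D)
    ≡⟨ length-wrap i {Y = U ∷ r ++ D ∷ []} (begin
         length (FF n r ++ U ∷ D ∷ [])   ≡⟨ length-++ (FF n r) ⟩
         length (FF n r) + 2             ≡⟨ cong (_+ 2) (preserved tr lr) ⟩
         length r + 2                    ≡⟨ +-suc (length r) 1 ⟩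
         suc (length r + 1)              ≡⟨ cong suc (sym (length-++ r)) ⟩
         length (U ∷ r ++ D ∷ [])        ∎) ⟩
  length (U ∷ ((U ∷ r ++ D ∷ []) ++ peaks i) ++ D ∷ []) ∎
  where
  open ≡-Reasoning
  lr : length r ≤ n
  lr = ≤-trans (≤-trans (length-++-≤ˡ r) (n≤1+n _)) (≤-trans (length-++-≤ˡ (U ∷ r ++ D ∷ [])) le)
length-FprimBody {q = q} preserved tq@(arch _ (arch _ _)) i le =
  length-wrap i {Y = q} (preserved tq (≤-trans (length-++-≤ˡ q) le))

length-Fprim : LengthPreserved n → IsDyck a → length a ≤ n →
  length (Fprim n (U ∷ a ++ D ∷ [])) ≡ length (U ∷ a ++ D ∷ [])
length-Fprim {n} {a} preserved da le = begin
  length (Fprim n (U ∷ a ++ D ∷ []))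
    ≡⟨ cong length (Fprim-arches n a tq) ⟩
  length (FprimBody n (proj₁ (splitQ a)) (proj₂ (splitQ a)) (arches tq))
    ≡⟨ length-FprimBody preserved tq _ (subst (λ w → length w ≤ n) (splitQ-sound a) le) ⟩
  length (U ∷ (proj₁ (splitQ a) ++ peaks (proj₂ (splitQ a))) ++ D ∷ [])
    ≡⟨ cong (λ w → length (U ∷ w ++ D ∷ [])) (sym (splitQ-sound a)) ⟩
  length (U ∷ a ++ D ∷ []) ∎
  where
  open ≡-Reasoning
  tq = toTree (splitQ-Dyck da)

length-arches : LengthPreserved n → (t : DyckTree w) → length w ≤ suc n →
  length (concatMap (Fprim n) (arches t)) ≡ length w
length-arches _ empty _ = refl
length-arches {n} preserved (arch {a} {b} ta tb) (s≤s le) = begin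
  length (Fprim n (U ∷ a ++ D ∷ []) ++ concatMap (Fprim n) (arches tb))
    ≡⟨ length-++ (Fprim n (U ∷ a ++ D ∷ [])) ⟩
  length (Fprim n (U ∷ a ++ D ∷ [])) + length (concatMap (Fprim n) (arches tb))
    ≡⟨ cong₂ _+_ (length-Fprim preserved (fromTree ta) la) (length-arches preserved tb lb) ⟩
  length (U ∷ a ++ D ∷ []) + length b
    ≡⟨ sym (length-++ (U ∷ a ++ D ∷ [])) ⟩
  length ((U ∷ a ++ D ∷ []) ++ b)
    ≡⟨ cong length (arch-++ a b) ⟩
  length (U ∷ a ++ D ∷ b) ∎
  where
  open ≡-Reasoning
  la : length a ≤ n
  la = ≤-trans (length-++-≤ˡ a) le
  lb : length b ≤ suc n
  lb = ≤-trans (≤-trans (n≤1+n _) (length-++-≤ʳ (D ∷ b) {a})) (≤-trans le (n≤1+n n))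

length-FF : ∀ n → LengthPreserved n
length-FF zero    empty      _ = refl
length-FF zero    (arch _ _) ()
length-FF (suc n) t          le rewrite components-arches t = length-arches (length-FF n) t le

-- Fixed points of F

FixedPointsCharacterised : ℕ → Set
FixedPointsCharacterised n = ∀ {w} → DyckTree w → length w ≤ n → (FF n w ≡ w) ⇔ PatternFree w

both-false : ∀ {P Q : Set} → ¬ P → ¬ Q → P ⇔ Q
both-false ¬p ¬q = mk⇔ (λ p → ⊥-elim (¬p p)) (λ q → ⊥-elim (¬q q))

arch-≡⇔ : (U ∷ x ++ D ∷ [] ≡ U ∷ y ++ D ∷ []) ⇔ (x ≡ y)
arch-≡⇔ {x} {y} = mk⇔ (λ e → ++-cancelʳ (D ∷ []) x y (∷-injectiveʳ e)) (cong (λ w → U ∷ w ++ D ∷ []))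

safeInterior-[] : SafeInterior []
safeInterior-[] = (λ (y , e) → case ++-conicalʳ y _ (sym e) of λ ()) , (λ _ _ ())

safeInterior-UD : SafeInterior (U ∷ D ∷ [])
safeInterior-UD = (λ _ → refl) , (λ r _ e → sym (++-cancelʳ (D ∷ []) [] r (∷-injectiveʳ e)))

safeInterior-composite : IsDyck x → ¬ EndsWith (U ∷ D ∷ []) (U ∷ x ++ D ∷ U ∷ y) →
  SafeInterior (U ∷ x ++ D ∷ U ∷ y)
safeInterior-composite dx irreducible =
  (λ ends → ⊥-elim (irreducible ends)) ,
  (λ r dr e → case proj₂ (firstReturn-unique dx dr (∷-injectiveʳ e)) of λ ())

-- For i ≥ 1 the target U q (UD)^i D ends with UDD, and q (UD)^i ends with UD, so it is not safe.
peaks-unfixed : ∀ q k {X} → q ++ peaks k ≢ [] → EndsWith (D ∷ D ∷ D ∷ []) X →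
  (X ≡ U ∷ (q ++ peaks (suc k)) ++ D ∷ []) ⇔ (PatternFree (q ++ peaks (suc k)) × SafeInterior (q ++ peaks (suc k)))
peaks-unfixed q k ≢[] endsDDD = both-false
  (λ e → endsWith-DDD⇒¬UDD endsDDD (U ∷ (q ++ peaks k) , trans e (cong (U ∷_)
    (trans (cong (_++ D ∷ []) ends) (++-assoc (q ++ peaks k) (U ∷ D ∷ []) (D ∷ []))))))
  (λ (_ , endsUD , _) → ≢[] (++-cancelʳ (U ∷ D ∷ []) (q ++ peaks k) [] (trans (sym ends) (endsUD (q ++ peaks k , ends)))))
  where
  ends : q ++ peaks (suc k) ≡ (q ++ peaks k) ++ U ∷ D ∷ []
  ends = trans (cong (q ++_) (peaks-∷ʳ k)) (sym (++-assoc q (peaks k) (U ∷ D ∷ [])))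

peaks-zero : ∀ {X} → (X ≡ U ∷ q ++ D ∷ []) ⇔ (PatternFree q × SafeInterior q) →
  (X ≡ U ∷ (q ++ peaks 0) ++ D ∷ []) ⇔ (PatternFree (q ++ peaks 0) × SafeInterior (q ++ peaks 0))
peaks-zero {q} {X} = subst (λ w → (X ≡ U ∷ w ++ D ∷ []) ⇔ (PatternFree w × SafeInterior w)) (sym (++-identityʳ q))

FprimBody-fixed⇔ : FixedPointsCharacterised n → (tq : DyckTree q) → ¬ EndsWith (U ∷ D ∷ []) q →
  ∀ i → length (q ++ peaks i) ≤ n →
  (FprimBody n q i (arches tq) ≡ U ∷ (q ++ peaks i) ++ D ∷ []) ⇔ (PatternFree (q ++ peaks i) × SafeInterior (q ++ peaks i))
FprimBody-fixed⇔ {n} _ empty _ zero _ rewrite FF-[] n =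
  mk⇔ (λ _ → patternFree-short z≤n , safeInterior-[]) (λ _ → refl)
FprimBody-fixed⇔ {n} _ empty _ (suc zero) _ rewrite FF-[] n =
  mk⇔ (λ _ → patternFree-short (s≤s (s≤s z≤n)) , safeInterior-UD) (λ _ → refl)
FprimBody-fixed⇔ {n} _ empty _ (suc (suc k)) _ rewrite FF-[] n =
  peaks-unfixed [] (suc k) (λ ()) (endsWith-++ˡ (replicate (suc (suc (suc k))) U) (endsWith-D-replicate ([] , refl) k))
FprimBody-fixed⇔ _ (arch empty empty) irreducible _ _ = ⊥-elim (irreducible ([] , refl))
FprimBody-fixed⇔ {n} _ (arch {r} tr@(arch _ _) empty) _ zero _ = peaks-zero (both-false
  (λ e → endsWith-DDD⇒¬UDD (subst (EndsWith (D ∷ D ∷ D ∷ [])) (sym e) targetDDD)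
                            (U ∷ FF n (inner (U ∷ r ++ D ∷ [])) , refl))
  (λ (_ , _ , notPrimitive) → case notPrimitive r (fromTree tr) refl of λ ()))
  where
  targetDDD : EndsWith (D ∷ D ∷ D ∷ []) (U ∷ (U ∷ r ++ D ∷ []) ++ D ∷ [])
  targetDDD = endsWith-++ˡ (U ∷ []) (endsWith-++ʳ (D ∷ []) (endsWith-++ˡ (U ∷ []) (endsWith-++ʳ (D ∷ [])
                (Dyck-endsWith-D (fromTree tr) (λ ())))))
FprimBody-fixed⇔ {n} _ (arch {r} (arch _ _) empty) _ (suc k) _ =
  peaks-unfixed (U ∷ r ++ D ∷ []) k (λ ()) (endsWith-++ˡ (replicate (suc (suc k)) U)
    (endsWith-++ˡ (FF n (inner (U ∷ r ++ D ∷ []))) (endsWith-++ˡ (U ∷ []) (endsWith-D-replicate ([] , refl) k))))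
FprimBody-fixed⇔ {q = q} fixed tq@(arch tx (arch _ _)) irreducible zero le = peaks-zero
  (⇔-trans arch-≡⇔ (⇔-trans (fixed tq (≤-trans (length-++-≤ˡ q) le))
    (mk⇔ (_, safeInterior-composite (fromTree tx) irreducible) proj₁)))
FprimBody-fixed⇔ {n} {q} _ tq@(arch _ (arch _ _)) _ (suc k) le =
  peaks-unfixed q k (λ ()) (endsWith-++ˡ (replicate (suc (suc k)) U)
    (endsWith-D-replicate (FF-endsWith-D tq (λ ()) (≤-trans (length-++-≤ˡ q) le)) k))

Fprim-fixed⇔ : FixedPointsCharacterised n → IsDyck a → length a ≤ n →
  (Fprim n (U ∷ a ++ D ∷ []) ≡ U ∷ a ++ D ∷ []) ⇔ (PatternFree a × SafeInterior a)
Fprim-fixed⇔ {n} {a} fixed da le =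
  subst (λ w → (Fprim n (U ∷ a ++ D ∷ []) ≡ U ∷ w ++ D ∷ []) ⇔ (PatternFree w × SafeInterior w))
        (sym (splitQ-sound a))
    (subst (λ X → (X ≡ _) ⇔ _) (sym (Fprim-arches n a tq))
      (FprimBody-fixed⇔ fixed tq (splitQ-irreducible a) _ (subst (λ w → length w ≤ n) (splitQ-sound a) le)))
  where tq = toTree (splitQ-Dyck da)

≡-target⇔ : y ≡ y' → (x ≡ y) ⇔ (x ≡ y')
≡-target⇔ e = mk⇔ (λ e' → trans e' e) (λ e' → trans e' (sym e))

arches-fixed⇔ : FixedPointsCharacterised n → (t : DyckTree w) → length w ≤ suc n →
  (concatMap (Fprim n) (arches t) ≡ w) ⇔ PatternFree w
arches-fixed⇔ _ empty _ = mk⇔ (λ _ → patternFree-short z≤n) (λ _ → refl)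
arches-fixed⇔ {n} fixed (arch {a} {b} ta tb) (s≤s le) = begin
  (Fprim n c ++ rest ≡ U ∷ a ++ D ∷ b)               ≈⟨ ≡-target⇔ (sym (arch-++ a b)) ⟩
  (Fprim n c ++ rest ≡ c ++ b)                       ≈⟨ ++-≡-++⇔ (Fprim n c) c (length-Fprim (length-FF n) da la) ⟩
  (Fprim n c ≡ c × rest ≡ b)                         ≈⟨ Fprim-fixed⇔ fixed da la ×-⇔ arches-fixed⇔ fixed tb lb ⟩
  ((PatternFree a × SafeInterior a) × PatternFree b) ≈⟨ patternFree-arch da (fromTree tb) ⟨
  PatternFree (U ∷ a ++ D ∷ b)                       ∎
  where
  open ⇔-Reasoning
  c    = U ∷ a ++ D ∷ []
  rest = concatMap (Fprim n) (arches tb)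
  da   = fromTree ta
  la : length a ≤ n
  la = ≤-trans (length-++-≤ˡ a) le
  lb : length b ≤ suc n
  lb = ≤-trans (≤-trans (n≤1+n _) (length-++-≤ʳ (D ∷ b) {a})) (≤-trans le (n≤1+n n))

FF-fixed⇔ : ∀ n → FixedPointsCharacterised n
FF-fixed⇔ zero    empty      _ = mk⇔ (λ _ → patternFree-short z≤n) (λ _ → refl)
FF-fixed⇔ zero    (arch _ _) ()
FF-fixed⇔ (suc n) t          le rewrite components-arches t = arches-fixed⇔ (FF-fixed⇔ n) t le

mainTheorem2 : (P : Word) → IsDyck P →
    (F P ≡ P) ⇔
      ((¬ Factor (D ∷ U ∷ D ∷ D ∷ []) P) ×
       (¬ (∃[ Q ] (IsDyck Q × Q ≢ [] × Factor (U ∷ U ∷ Q ++ D ∷ D ∷ []) P))))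
mainTheorem2 P dP = FF-fixed⇔ (length P) (toTree dP) ≤-refl
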